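{- Let $\mu=(\mu_1,\dots,\mu_k)\vdash n$ and $a=(a_1,\dots,a_h)\vDash n$, and let $i$ be an integer with $1\le i\le k$. If there exists a tableau $T\in\mathrm{STab}(\mu,a)$ such that $T(i,\mu_i)=h$, then $i\in R(\mu,a)$.
   Context: A composition $a\vDash n$ is a sequence of positive integers summing to $n$; a partition $\mu\vdash n$ is a non-increasing composition, with $\mu_i=0$ beyond its parts and trailing zeros deleted. For compositions $a=(a_1,\dots,a_h)$, $b=(b_1,\dots,b_k)$ of $n$, $a\unrhd b$ means $k\ge h$ and $\sum_{i=1}^j a_i\ge\sum_{i=1}^jb_i$ for $j=1,\dots,h$. $\lambda(a)$ is the non-increasing rearrangement of $a$. $\mu^{(i)}$ is $\mu$ with its $i$-th entry decreased by $1$. $\tilde a=(a_1,\dots,a_{h-1},a_h-1)$ if $a_h\ge2$, $\tilde a=(a_1,\dots,a_{h-1})$ if $a_h=1$. $D_\mu=\{(i,j):1\le i\le k,1\le j\le\mu_i\}$; $\mathrm{STab}(\mu,a)$ is the set of maps $T:D_\mu\to\{1,\dots,h\}$ with $T(i,j)\le T(i,j+1)$, $T(i,j)<T(i+1,j)$ and $|T^{ -1}(\{i\})|=a_i$ for all $i$. $R(\mu,a)$ is the set of $i\in\{1,\dots,k\}$ with $\mu_i>\mu_{i+1}$ and $\mu^{(i)}\unrhd\lambda(\tilde a)$. -}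

module Defs where

open import Data.Nat using (ℕ; zero; suc; _+_; _∸_; _≤_; _<_; _≥_; _>_; _≟_; _≤?_)
open import Data.List using (List; []; _∷_; length; take; filter; map; concatMap; reverse; dropWhile)
open import Data.Nat.ListAction using (sum)
open import Data.List.Relation.Unary.All using (All)
open import Data.Product using (_×_; Σ; _,_)
open import Relation.Binary.PropositionalEquality using (_≡_)
open import Relation.Nullary.Decidable using (does)
open import Data.Bool using (if_then_else_)

-- All lists below are 1-indexed in the mathematical sense:
-- entry i of a list (i ≥ 1) is  at l i ; entries beyond the length (and index 0) are 0.
at : List ℕ → ℕ → ℕ
at []       _             = 0
at (x ∷ xs) 0             = 0
at (x ∷ xs) 1             = x
at (x ∷ xs) (suc (suc i)) = at xs (suc i)

IsComposition : List ℕ → ℕ → Set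
IsComposition a n = All (λ x → x ≥ 1) a × sum a ≡ n

data NonIncreasing : List ℕ → Set where
  []  : NonIncreasing []
  [_] : ∀ x → NonIncreasing (x ∷ [])
  _∷_ : ∀ {x y ys} → x ≥ y → NonIncreasing (y ∷ ys) → NonIncreasing (x ∷ y ∷ ys)

IsPartition : List ℕ → ℕ → Set
IsPartition μ n = IsComposition μ n × NonIncreasing μ

psum : List ℕ → ℕ → ℕ
psum a j = sum (take j a)

_⊵_ : List ℕ → List ℕ → Set
a ⊵ b = (length b ≥ length a) × (∀ j → 1 ≤ j → j ≤ length a → psum a j ≥ psum b j)

insertDesc : ℕ → List ℕ → List ℕ
insertDesc x []       = x ∷ []
insertDesc x (y ∷ ys) = if does (y ≤? x) then x ∷ y ∷ ys else y ∷ insertDesc x ys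

sortDesc : List ℕ → List ℕ
sortDesc []       = []
sortDesc (x ∷ xs) = insertDesc x (sortDesc xs)

dropTrailingZeros : List ℕ → List ℕ
dropTrailingZeros l = reverse (dropWhile (λ x → x ≟ 0) (reverse l))

decAt : List ℕ → ℕ → List ℕ
decAt []       _             = []
decAt (x ∷ xs) 0             = x ∷ xs
decAt (x ∷ xs) 1             = (x ∸ 1) ∷ xs
decAt (x ∷ xs) (suc (suc i)) = x ∷ decAt xs (suc i)

lower : List ℕ → ℕ → List ℕ
lower μ i = dropTrailingZeros (decAt μ i)

tilde : List ℕ → List ℕ
tilde []           = []
tilde (x ∷ [])     = if does (x ≟ 1) then [] else (x ∸ 1) ∷ []
tilde (x ∷ y ∷ ys) = x ∷ tilde (y ∷ ys)

InDiagram : List ℕ → ℕ → ℕ → Set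
InDiagram μ i j = 1 ≤ i × i ≤ length μ × 1 ≤ j × j ≤ at μ i

upFrom1 : ℕ → List ℕ
upFrom1 0       = []
upFrom1 (suc m) = upFrom1 m Data.List.++ (suc m ∷ [])

cells : List ℕ → List (ℕ × ℕ)
cells μ = concatMap (λ i → map (λ j → (i , j)) (upFrom1 (at μ i))) (upFrom1 (length μ))

countValue : List ℕ → (ℕ → ℕ → ℕ) → ℕ → ℕ
countValue μ T r = length (filter (λ c → T (Data.Product.proj₁ c) (Data.Product.proj₂ c) ≟ r) (cells μ))

-- T ∈ STab(μ, a); T is given as a function on ℕ × ℕ, only its values on D_μ matter
IsSTab : List ℕ → List ℕ → (ℕ → ℕ → ℕ) → Set
IsSTab μ a T =
  (∀ i j → InDiagram μ i j → 1 ≤ T i j × T i j ≤ length a)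
  × (∀ i j → InDiagram μ i j → InDiagram μ i (suc j) → T i j ≤ T i (suc j))
  × (∀ i j → InDiagram μ i j → InDiagram μ (suc i) j → T i j < T (suc i) j)
  × (∀ r → 1 ≤ r → r ≤ length a → countValue μ T r ≡ at a r)

InR : List ℕ → List ℕ → ℕ → Set
InR μ a i = 1 ≤ i × i ≤ length μ × at μ i > at μ (suc i) × lower μ i ⊵ sortDesc (tilde a)

module Submission where

-- Removing the corner cell (i, μᵢ), which holds the largest entry h, leaves a
-- column-strict filling of ν = μ⁽ⁱ⁾ whose content is exactly ã.  If μᵢ = μᵢ₊₁, the
-- cell below the corner would need an entry larger than h, so μᵢ > μᵢ₊₁.
-- The j largest parts of ã count the cells of ν whose entries lie in some j-element
-- set S of values.  A column contains each value at most once, so column c holds at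
-- most min(j, height of c) of these cells, and summing over the columns gives
-- ν₁ + ⋯ + νⱼ; this is ν ⊵ λ(ã).  Finally, row r of ν starts with an entry
-- T(r,1) ≥ r that occurs in ν, so r ≤ ℓ(ã).

open import Data.Bool using (Bool; true; false)
open import Data.List using (List; []; _∷_; _++_; _∷ʳ_; length; map; filter; concatMap; reverse; dropWhile)
open import Data.List.Properties using (map-++; map-∘; map-cong; length-map; reverse-++; unfold-reverse)
open import Data.List.Relation.Unary.All as All using (All; []; _∷_)
import Data.List.Relation.Unary.All.Properties as All
open import Data.List.Relation.Unary.Unique.Propositional using (Unique; []; _∷_)
import Data.List.Relation.Unary.Unique.Propositional.Properties as Unique
open import Data.Nat
open import Data.Nat.ListAction using (sum)
open import Data.Nat.ListAction.Properties using (sum-++)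
open import Data.Nat.Properties
open import Algebra.Properties.CommutativeSemigroup +-commutativeSemigroup
  using (interchange; x∙yz≈y∙xz; xy∙z≈xz∙y)
open import Data.Product using (Σ; ∃; _×_; _,_; proj₁; proj₂)
open import Data.Sum using (_⊎_; inj₁; inj₂)
open import Function using (_∘_)
open import Relation.Binary.PropositionalEquality
open import Relation.Nullary.Decidable using (does; yes; no; dec-true; dec-false)
open import Relation.Nullary.Negation using (contradiction)
open import Relation.Unary using (Pred; Decidable)

open import Defs

-- Iverson brackets and sums over 1, …, m

𝟙 : Bool → ℕ
𝟙 true  = 1
𝟙 false = 0

⟦_≡_⟧ : ℕ → ℕ → ℕ
⟦ m ≡ n ⟧ = 𝟙 (m ≡ᵇ n)

⟦_≤_⟧ : ℕ → ℕ → ℕ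
⟦ m ≤ n ⟧ = 𝟙 (m ≤ᵇ n)

⟦≡⟧-refl : ∀ m → ⟦ m ≡ m ⟧ ≡ 1
⟦≡⟧-refl m = cong 𝟙 (dec-true (m ≟ m) refl)

⟦≡⟧-≢ : ∀ {m n} → m ≢ n → ⟦ m ≡ n ⟧ ≡ 0
⟦≡⟧-≢ {m} {n} m≢n = cong 𝟙 (dec-false (m ≟ n) m≢n)

⟦≤⟧-≤ : ∀ {m n} → m ≤ n → ⟦ m ≤ n ⟧ ≡ 1
⟦≤⟧-≤ {m} {n} m≤n = cong 𝟙 (dec-true (m ≤? n) m≤n)

⟦≤⟧-> : ∀ {m n} → n < m → ⟦ m ≤ n ⟧ ≡ 0
⟦≤⟧-> {m} {n} n<m = cong 𝟙 (dec-false (m ≤? n) (<⇒≱ n<m))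

-- ∑[ r ≤ m ] f r = f 1 + ⋯ + f m: indices start at 1, as for `at`.
∑ : ℕ → (ℕ → ℕ) → ℕ
∑ zero    f = 0
∑ (suc m) f = ∑ m f + f (suc m)

infix 5 ∑
syntax ∑ m (λ r → e) = ∑[ r ≤ m ] e

∑-cong : ∀ m {f g} → (∀ {r} → 1 ≤ r → r ≤ m → f r ≡ g r) → ∑ m f ≡ ∑ m g
∑-cong zero    eq = refl
∑-cong (suc m) eq =
  cong₂ _+_ (∑-cong m (λ 1≤r r≤m → eq 1≤r (m≤n⇒m≤1+n r≤m))) (eq (s≤s z≤n) ≤-refl)

∑-mono-≤ : ∀ m {f g} → (∀ {r} → 1 ≤ r → r ≤ m → f r ≤ g r) → ∑ m f ≤ ∑ m g
∑-mono-≤ zero    le = z≤n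
∑-mono-≤ (suc m) le =
  +-mono-≤ (∑-mono-≤ m (λ 1≤r r≤m → le 1≤r (m≤n⇒m≤1+n r≤m))) (le (s≤s z≤n) ≤-refl)

∑-zero : ∀ m → (∑[ r ≤ m ] 0) ≡ 0
∑-zero zero    = refl
∑-zero (suc m) = cong (_+ 0) (∑-zero m)

∑-const-1 : ∀ m → (∑[ r ≤ m ] 1) ≡ m
∑-const-1 zero    = refl
∑-const-1 (suc m) = trans (cong (_+ 1) (∑-const-1 m)) (+-comm m 1)

∑-distrib-+ : ∀ m f g → (∑[ r ≤ m ] (f r + g r)) ≡ ∑ m f + ∑ m g
∑-distrib-+ zero    f g = refl
∑-distrib-+ (suc m) f g =
  trans (cong (_+ (f (suc m) + g (suc m))) (∑-distrib-+ m f g))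
        (interchange (∑ m f) (∑ m g) (f (suc m)) (g (suc m)))

∑-swap : ∀ m n (w : ℕ → ℕ → ℕ) →
         (∑[ r ≤ m ] ∑[ c ≤ n ] w r c) ≡ (∑[ c ≤ n ] ∑[ r ≤ m ] w r c)
∑-swap zero    n w = sym (∑-zero n)
∑-swap (suc m) n w =
  trans (cong (_+ ∑ n (w (suc m))) (∑-swap m n w)) (sym (∑-distrib-+ n _ (w (suc m))))

∑-head : ∀ m f → ∑ (suc m) f ≡ f 1 + (∑[ r ≤ m ] f (suc r))
∑-head zero    f = +-comm 0 (f 1)
∑-head (suc m) f = trans (cong (_+ f (suc (suc m))) (∑-head m f)) (+-assoc (f 1) _ _)

∑-pred : ∀ {m} f → 1 ≤ m → ∑ m f ≡ ∑ (m ∸ 1) f + f m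
∑-pred {suc m} f _ = refl

∑-term-≤ : ∀ {m} f {r} → 1 ≤ r → r ≤ m → f r ≤ ∑ m f
∑-term-≤ {zero}  f 1≤r r≤0 = contradiction r≤0 (<⇒≱ 1≤r)
∑-term-≤ {suc m} f 1≤r r≤1+m with m≤n⇒m<n∨m≡n r≤1+m
... | inj₁ r<1+m = ≤-trans (∑-term-≤ f 1≤r (≤-pred r<1+m)) (m≤m+n _ _)
... | inj₂ refl  = m≤n+m _ _

∑-mono-range : ∀ f {j k} → j ≤ k → ∑ j f ≤ ∑ k f
∑-mono-range f {j} {suc k} j≤1+k with m≤n⇒m<n∨m≡n j≤1+k
... | inj₁ j<1+k = ≤-trans (∑-mono-range f (≤-pred j<1+k)) (m≤m+n _ _)
... | inj₂ refl  = ≤-refl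
∑-mono-range f {zero} {zero} z≤n = ≤-refl

∑-vanishing-tail : ∀ f {j k} → j ≤ k → (∀ {r} → j < r → r ≤ k → f r ≡ 0) → ∑ k f ≡ ∑ j f
∑-vanishing-tail f {k = zero}  z≤n     _    = refl
∑-vanishing-tail f {k = suc k} j≤1+k vanish with m≤n⇒m<n∨m≡n j≤1+k
... | inj₂ refl  = refl
... | inj₁ j<1+k =
  trans (cong₂ _+_ (∑-vanishing-tail f (≤-pred j<1+k) (λ j<r r≤k → vanish j<r (m≤n⇒m≤1+n r≤k)))
                   (vanish j<1+k ≤-refl))
        (+-identityʳ _)

∑-update : ∀ k {F G : ℕ → ℕ} {i d} → 1 ≤ i → i ≤ k →
           (∀ {r} → r ≢ i → F r ≡ G r) → F i ≡ G i + d → ∑ k F ≡ ∑ k G + d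
∑-update zero    1≤i i≤0 _ _ = contradiction i≤0 (<⇒≱ 1≤i)
∑-update (suc k) {F} {G} {i} {d} 1≤i i≤1+k others here with m≤n⇒m<n∨m≡n i≤1+k
... | inj₁ i<1+k =
  trans (cong₂ _+_ (∑-update k 1≤i (≤-pred i<1+k) others here) (others (>⇒≢ i<1+k)))
        (xy∙z≈xz∙y (∑ k G) d (G (suc k)))
... | inj₂ refl  =
  trans (cong₂ _+_ (∑-cong k (λ _ r≤k → others (<⇒≢ (s≤s r≤k)))) here)
        (sym (+-assoc (∑ k G) (G (suc k)) d))

∑-restrict : ∀ f {m M} → m ≤ M → ∑ m f ≡ (∑[ c ≤ M ] ⟦ c ≤ m ⟧ * f c)
∑-restrict f {m} {M} m≤M = sym (begin
  (∑[ c ≤ M ] ⟦ c ≤ m ⟧ * f c)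
    ≡⟨ ∑-vanishing-tail _ m≤M (λ m<c _ → cong (_* f _) (⟦≤⟧-> m<c)) ⟩
  (∑[ c ≤ m ] ⟦ c ≤ m ⟧ * f c)
    ≡⟨ ∑-cong m (λ _ c≤m → trans (cong (_* f _) (⟦≤⟧-≤ c≤m)) (*-identityˡ _)) ⟩
  ∑ m f ∎)
  where open ≡-Reasoning

sum-map-∑ : ∀ (S : List ℕ) m (w : ℕ → ℕ → ℕ) →
            sum (map (λ p → ∑[ r ≤ m ] w p r) S) ≡ (∑[ r ≤ m ] sum (map (λ p → w p r) S))
sum-map-∑ []      m w = sym (∑-zero m)
sum-map-∑ (p ∷ S) m w =
  trans (cong (∑ m (w p) +_) (sum-map-∑ S m w)) (sym (∑-distrib-+ m (w p) _))

sum-map-*ˡ : ∀ x f (S : List ℕ) → sum (map (λ p → x * f p) S) ≡ x * sum (map f S)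
sum-map-*ˡ x f []      = sym (*-zeroʳ x)
sum-map-*ˡ x f (p ∷ S) = trans (cong (x * f p +_) (sum-map-*ˡ x f S)) (sym (*-distribˡ-+ x (f p) _))

sum-map-mono-≤ : ∀ {f g} (S : List ℕ) → (∀ p → f p ≤ g p) → sum (map f S) ≤ sum (map g S)
sum-map-mono-≤ []      le = z≤n
sum-map-mono-≤ (p ∷ S) le = +-mono-≤ (le p) (sum-map-mono-≤ S le)

sum-map-≤-length : ∀ {f} (S : List ℕ) → (∀ p → f p ≤ 1) → sum (map f S) ≤ length S
sum-map-≤-length []      le = z≤n
sum-map-≤-length (p ∷ S) le = +-mono-≤ (le p) (sum-map-≤-length S le)

multiplicity-≤1 : ∀ {S} → Unique S → ∀ v → sum (map (λ p → ⟦ v ≡ p ⟧) S) ≤ 1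
multiplicity-≤1 []              v = z≤n
multiplicity-≤1 {p ∷ S} (p∉S ∷ S-unique) v with v ≟ p
... | no v≢p  = subst (_≤ 1) (cong (_+ _) (sym (⟦≡⟧-≢ v≢p))) (multiplicity-≤1 S-unique v)
... | yes refl = ≤-reflexive (cong₂ _+_ (⟦≡⟧-refl v) (absent p∉S))
  where
  absent : ∀ {S} → All (v ≢_) S → sum (map (λ q → ⟦ v ≡ q ⟧) S) ≡ 0
  absent []            = refl
  absent (v≢q ∷ v∉S) = cong₂ _+_ (⟦≡⟧-≢ v≢q) (absent v∉S)

at-zero : ∀ l → at l 0 ≡ 0
at-zero []      = refl
at-zero (_ ∷ _) = refl

at-beyond : ∀ l {r} → length l < r → at l r ≡ 0
at-beyond []      _                        = refl
at-beyond (x ∷ l) {suc (suc r)} (s≤s lt) = at-beyond l lt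

at-pos⇒≤length : ∀ l {r} → 1 ≤ at l r → r ≤ length l
at-pos⇒≤length l {r} 1≤l[r] with r ≤? length l
... | yes r≤ = r≤
... | no  r≰ = contradiction (at-beyond l (≰⇒> r≰)) (>⇒≢ 1≤l[r])

All⇒at : ∀ {P : ℕ → Set} l {r} → All P l → 1 ≤ r → r ≤ length l → P (at l r)
All⇒at (x ∷ l) {suc zero}    (px ∷ _)  _ _         = px
All⇒at (x ∷ l) {suc (suc r)} (_ ∷ pl) _ (s≤s r≤l) = All⇒at l pl (s≤s z≤n) r≤l

at-decAt : ∀ l i r → at (decAt l i) r ≡ at l r ∸ ⟦ i ≡ r ⟧
at-decAt []      i             r             = sym (0∸n≡0 ⟦ i ≡ r ⟧)
at-decAt (x ∷ l) zero          zero          = refl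
at-decAt (x ∷ l) zero          (suc r)       = refl
at-decAt (x ∷ l) (suc zero)    zero          = refl
at-decAt (x ∷ l) (suc (suc i)) zero          = refl
at-decAt (x ∷ l) (suc zero)    (suc zero)    = refl
at-decAt (x ∷ l) (suc zero)    (suc (suc r)) = refl
at-decAt (x ∷ l) (suc (suc i)) (suc zero)    = refl
at-decAt (x ∷ l) (suc (suc i)) (suc (suc r)) = at-decAt l (suc i) (suc r)

at-tilde : ∀ a p → at (tilde a) p ≡ at a p ∸ ⟦ length a ≡ p ⟧
at-tilde []                 p             = sym (0∸n≡0 ⟦ 0 ≡ p ⟧)
at-tilde (zero ∷ [])        zero          = refl
at-tilde (zero ∷ [])        (suc zero)    = refl
at-tilde (zero ∷ [])        (suc (suc p)) = refl
at-tilde (suc zero ∷ [])    zero          = refl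
at-tilde (suc zero ∷ [])    (suc zero)    = refl
at-tilde (suc zero ∷ [])    (suc (suc p)) = refl
at-tilde (suc (suc x) ∷ []) zero          = refl
at-tilde (suc (suc x) ∷ []) (suc zero)    = refl
at-tilde (suc (suc x) ∷ []) (suc (suc p)) = refl
at-tilde (x ∷ y ∷ ys)       zero          = refl
at-tilde (x ∷ y ∷ ys)       (suc zero)    = refl
at-tilde (x ∷ y ∷ ys)       (suc (suc p)) = at-tilde (y ∷ ys) (suc p)

at-tilde-≤ : ∀ a p → at (tilde a) p ≤ at a p
at-tilde-≤ a p = subst (_≤ at a p) (sym (at-tilde a p)) (m∸n≤m (at a p) ⟦ length a ≡ p ⟧)

psum≡∑at : ∀ l j → psum l j ≡ (∑[ r ≤ j ] at l r)
psum≡∑at []      zero    = refl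
psum≡∑at []      (suc j) = sym (∑-zero (suc j))
psum≡∑at (x ∷ l) zero    = refl
psum≡∑at (x ∷ l) (suc j) = sym (begin
  (∑[ r ≤ suc j ] at (x ∷ l) r)       ≡⟨ ∑-head j (at (x ∷ l)) ⟩
  x + (∑[ r ≤ j ] at (x ∷ l) (suc r)) ≡⟨ cong (x +_) (∑-cong j λ { {suc r} _ _ → refl }) ⟩
  x + (∑[ r ≤ j ] at l r)             ≡⟨ cong (x +_) (psum≡∑at l j) ⟨
  psum (x ∷ l) (suc j)                ∎)
  where open ≡-Reasoning

trimCons : ℕ → List ℕ → List ℕ
trimCons zero [] = []
trimCons x    xs = x ∷ xs

trimCons-snoc : ∀ x ws y → trimCons x (ws ∷ʳ y) ≡ x ∷ ws ∷ʳ y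
trimCons-snoc zero    []      y = refl
trimCons-snoc zero    (_ ∷ _) y = refl
trimCons-snoc (suc x) ws      y = refl

reverse-dropWhile-snoc : ∀ zs x →
  reverse (dropWhile (_≟ 0) (zs ∷ʳ x)) ≡ trimCons x (reverse (dropWhile (_≟ 0) zs))
reverse-dropWhile-snoc []           zero    = refl
reverse-dropWhile-snoc []           (suc x) = refl
reverse-dropWhile-snoc (zero ∷ zs)  x       = reverse-dropWhile-snoc zs x
reverse-dropWhile-snoc (suc z ∷ zs) x       = begin
  reverse ((suc z ∷ zs) ∷ʳ x)       ≡⟨ reverse-++ (suc z ∷ zs) (x ∷ []) ⟩
  x ∷ reverse (suc z ∷ zs)          ≡⟨ cong (x ∷_) (unfold-reverse (suc z) zs) ⟩
  x ∷ reverse zs ∷ʳ suc z           ≡⟨ trimCons-snoc x (reverse zs) (suc z) ⟨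
  trimCons x (reverse zs ∷ʳ suc z)  ≡⟨ cong (trimCons x) (unfold-reverse (suc z) zs) ⟨
  trimCons x (reverse (suc z ∷ zs)) ∎
  where open ≡-Reasoning

dropTrailingZeros-∷ : ∀ x xs → dropTrailingZeros (x ∷ xs) ≡ trimCons x (dropTrailingZeros xs)
dropTrailingZeros-∷ x xs =
  trans (cong (reverse ∘ dropWhile (_≟ 0)) (unfold-reverse x xs))
        (reverse-dropWhile-snoc (reverse xs) x)

at-trimCons : ∀ x ys r → at (trimCons x ys) r ≡ at (x ∷ ys) r
at-trimCons zero    []      zero          = refl
at-trimCons zero    []      (suc zero)    = refl
at-trimCons zero    []      (suc (suc r)) = refl
at-trimCons zero    (_ ∷ _) r             = refl
at-trimCons (suc x) ys      r             = refl

at-∷-cong : ∀ x {ys zs} → (∀ r → at ys r ≡ at zs r) → ∀ r → at (x ∷ ys) r ≡ at (x ∷ zs) r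
at-∷-cong x eq zero          = refl
at-∷-cong x eq (suc zero)    = refl
at-∷-cong x eq (suc (suc r)) = eq (suc r)

at-dropTrailingZeros : ∀ l r → at (dropTrailingZeros l) r ≡ at l r
at-dropTrailingZeros []      r = refl
at-dropTrailingZeros (x ∷ l) r = begin
  at (dropTrailingZeros (x ∷ l)) r          ≡⟨ cong (λ l′ → at l′ r) (dropTrailingZeros-∷ x l) ⟩
  at (trimCons x (dropTrailingZeros l)) r   ≡⟨ at-trimCons x _ r ⟩
  at (x ∷ dropTrailingZeros l) r            ≡⟨ at-∷-cong x (at-dropTrailingZeros l) r ⟩
  at (x ∷ l) r                              ∎
  where open ≡-Reasoning

length-trimCons-≤ : ∀ x ys → length (trimCons x ys) ≤ suc (length ys)
length-trimCons-≤ zero    []      = z≤n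
length-trimCons-≤ zero    (_ ∷ _) = ≤-refl
length-trimCons-≤ (suc x) ys      = ≤-refl

at-∷-vanishing : ∀ x {l m} → (∀ {r} → suc m < r → at (x ∷ l) r ≡ 0) → ∀ {r} → m < r → at l r ≡ 0
at-∷-vanishing x vanish {suc r} m<1+r = vanish (s≤s m<1+r)

length-dropTrailingZeros-≤ : ∀ l m → (∀ {r} → m < r → at l r ≡ 0) → length (dropTrailingZeros l) ≤ m
length-dropTrailingZeros-≤ []      m       _      = z≤n
length-dropTrailingZeros-≤ (x ∷ l) (suc m) vanish rewrite dropTrailingZeros-∷ x l =
  ≤-trans (length-trimCons-≤ x _) (s≤s (length-dropTrailingZeros-≤ l m (at-∷-vanishing x vanish)))
length-dropTrailingZeros-≤ (x ∷ l) zero    vanish rewrite dropTrailingZeros-∷ x l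
  with dropTrailingZeros l
     | length-dropTrailingZeros-≤ l 0 (at-∷-vanishing x (vanish ∘ <-trans z<s))
     | vanish {1} z<s
... | [] | _ | refl = z≤n

length-insertDesc : ∀ x ys → length (insertDesc x ys) ≡ suc (length ys)
length-insertDesc x []       = refl
length-insertDesc x (y ∷ ys) with y ≤ᵇ x
... | true  = refl
... | false = cong suc (length-insertDesc x ys)

length-sortDesc : ∀ l → length (sortDesc l) ≡ length l
length-sortDesc []      = refl
length-sortDesc (x ∷ l) = trans (length-insertDesc x (sortDesc l)) (cong suc (length-sortDesc l))

psum-insertDesc : ∀ x ys j → psum (insertDesc x ys) j ≡ psum ys j
                           ⊎ ∃ λ j′ → j ≡ suc j′ × psum (insertDesc x ys) j ≡ x + psum ys j′
psum-insertDesc x []       zero    = inj₁ refl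
psum-insertDesc x []       (suc j) = inj₂ (j , refl , refl)
psum-insertDesc x (y ∷ ys) j with y ≤ᵇ x | j
... | true  | zero  = inj₁ refl
... | true  | suc j = inj₂ (j , refl , refl)
... | false | zero  = inj₁ refl
... | false | suc j with psum-insertDesc x ys j
...   | inj₁ eq                = inj₁ (cong (y +_) eq)
...   | inj₂ (j′ , refl , eq) = inj₂ (suc j′ , refl , trans (cong (y +_) eq) (x∙yz≈y∙xz y x _))

shifted-positive : ∀ {S} → All (1 ≤_) S → All (1 ≤_) (map suc S)
shifted-positive S-positive = All.map⁺ (All.map (λ _ → s≤s z≤n) S-positive)

sum-map-at-∷ : ∀ x l {S} → All (1 ≤_) S → sum (map (at (x ∷ l)) (map suc S)) ≡ sum (map (at l) S)
sum-map-at-∷ x l []                      = refl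
sum-map-at-∷ x l (s≤s z≤n ∷ S-positive) = cong (_ +_) (sum-map-at-∷ x l S-positive)

psum-sortDesc≤sum-at : ∀ l j → ∃ λ S → Unique S × All (1 ≤_) S × length S ≤ j
                                     × psum (sortDesc l) j ≤ sum (map (at l) S)
psum-sortDesc≤sum-at []      zero    = [] , [] , [] , z≤n , z≤n
psum-sortDesc≤sum-at []      (suc j) = [] , [] , [] , z≤n , z≤n
psum-sortDesc≤sum-at (x ∷ l) j with psum-insertDesc x (sortDesc l) j
... | inj₁ eq with psum-sortDesc≤sum-at l j
...   | S , S-unique , S-positive , |S|≤j , le =
  map suc S , Unique.map⁺ suc-injective S-unique , shifted-positive S-positive ,
  subst (_≤ j) (sym (length-map suc S)) |S|≤j ,
  subst₂ _≤_ (sym eq) (sym (sum-map-at-∷ x l S-positive)) le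
psum-sortDesc≤sum-at (x ∷ l) j | inj₂ (j′ , refl , eq) with psum-sortDesc≤sum-at l j′
...   | S , S-unique , S-positive , |S|≤j′ , le =
  1 ∷ map suc S , All.map⁺ (All.map 1≢suc S-positive) ∷ Unique.map⁺ suc-injective S-unique ,
  s≤s z≤n ∷ shifted-positive S-positive ,
  s≤s (subst (_≤ j′) (sym (length-map suc S)) |S|≤j′) ,
  subst₂ _≤_ (sym eq) (cong (x +_) (sym (sum-map-at-∷ x l S-positive))) (+-monoʳ-≤ x le)
  where
  1≢suc : ∀ {q} → 1 ≤ q → 1 ≢ suc q
  1≢suc (s≤s z≤n) ()

-- Column-strict fillings of a shape

-- Shapes are row-length functions such as `at μ`, which vanish at index 0,
-- so they are only required to decrease from index 1 on.
Antitone⁺ : (ℕ → ℕ) → Set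
Antitone⁺ f = ∀ {r} → 1 ≤ r → f (suc r) ≤ f r

antitone⁺-≤ : ∀ {f} → Antitone⁺ f → ∀ {r q} → 1 ≤ r → r ≤ q → f q ≤ f r
antitone⁺-≤ {f} anti {r} 1≤r r≤q = go (≤⇒≤′ r≤q)
  where
  go : ∀ {q} → r ≤′ q → f q ≤ f r
  go ≤′-refl        = ≤-refl
  go (≤′-step r≤′q) = ≤-trans (anti (≤-trans 1≤r (≤′⇒≤ r≤′q))) (go r≤′q)

NonIncreasing⇒antitone⁺ : ∀ {l} → NonIncreasing l → Antitone⁺ (at l)
NonIncreasing⇒antitone⁺ []                            _ = z≤n
NonIncreasing⇒antitone⁺ [ x ]           {suc zero}    _ = z≤n
NonIncreasing⇒antitone⁺ [ x ]           {suc (suc r)} _ = z≤n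
NonIncreasing⇒antitone⁺ (x≥y ∷ _)       {suc zero}    _ = x≥y
NonIncreasing⇒antitone⁺ (_ ∷ y∷ys-dec) {suc (suc r)} _ = NonIncreasing⇒antitone⁺ y∷ys-dec (s≤s z≤n)

ColumnStrict : (ℕ → ℕ) → (ℕ → ℕ → ℕ) → Set
ColumnStrict ν T = ∀ {r c} → 1 ≤ r → 1 ≤ c → c ≤ ν (suc r) → T r c < T (suc r) c

∑-transpose : ∀ {ν} → Antitone⁺ ν → ∀ k (w : ℕ → ℕ → ℕ) →
              (∑[ r ≤ k ] ∑[ c ≤ ν r ] w r c) ≡ (∑[ c ≤ ν 1 ] ∑[ r ≤ k ] ⟦ c ≤ ν r ⟧ * w r c)
∑-transpose {ν} anti k w =
  trans (∑-cong k (λ 1≤r _ → ∑-restrict (w _) (antitone⁺-≤ anti (s≤s z≤n) 1≤r))) (∑-swap k (ν 1) _)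

∑-row-lengths : ∀ {ν} → Antitone⁺ ν → ∀ j → (∑[ r ≤ j ] ν r) ≡ (∑[ c ≤ ν 1 ] ∑[ r ≤ j ] ⟦ c ≤ ν r ⟧)
∑-row-lengths {ν} anti j = begin
  (∑[ r ≤ j ] ν r)                         ≡⟨ ∑-cong j (λ _ _ → ∑-const-1 _) ⟨
  (∑[ r ≤ j ] ∑[ c ≤ ν r ] 1)              ≡⟨ ∑-transpose anti j (λ _ _ → 1) ⟩
  (∑[ c ≤ ν 1 ] ∑[ r ≤ j ] ⟦ c ≤ ν r ⟧ * 1) ≡⟨ ∑-cong (ν 1) (λ _ _ → ∑-cong j (λ _ _ → *-identityʳ _)) ⟩
  (∑[ c ≤ ν 1 ] ∑[ r ≤ j ] ⟦ c ≤ ν r ⟧)     ∎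
  where open ≡-Reasoning

-- ∑[ r ≤ j ] ⟦ c ≤ ν r ⟧ is the minimum of j and the height of column c.
∑-⟦≤⟧-prefix : ∀ {ν} → Antitone⁺ ν → ∀ {c x} j k →
               x ≤ j → x ≤ (∑[ r ≤ k ] ⟦ c ≤ ν r ⟧) → x ≤ (∑[ r ≤ j ] ⟦ c ≤ ν r ⟧)
∑-⟦≤⟧-prefix anti zero k x≤0 _ = x≤0
∑-⟦≤⟧-prefix {ν} anti {c} {x} j@(suc _) k x≤j x≤∑ with k ≤? j | c ≤? ν j
... | yes k≤j | _ = ≤-trans x≤∑ (∑-mono-range _ k≤j)
... | no  _   | yes c≤νj = subst (x ≤_) (sym (trans (∑-cong j full-row) (∑-const-1 j))) x≤j
  where
  full-row : ∀ {r} → 1 ≤ r → r ≤ j → ⟦ c ≤ ν r ⟧ ≡ 1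
  full-row 1≤r r≤j = ⟦≤⟧-≤ (≤-trans c≤νj (antitone⁺-≤ anti 1≤r r≤j))
... | no  k≰j | no  c≰νj = subst (x ≤_) (∑-vanishing-tail _ (<⇒≤ (≰⇒> k≰j)) empty-row) x≤∑
  where
  empty-row : ∀ {r} → j < r → r ≤ k → ⟦ c ≤ ν r ⟧ ≡ 0
  empty-row j<r _ = ⟦≤⟧-> (≤-<-trans (antitone⁺-≤ anti (s≤s z≤n) (<⇒≤ j<r)) (≰⇒> c≰νj))

content : (ℕ → ℕ) → ℕ → (ℕ → ℕ → ℕ) → ℕ → ℕ
content ν k T p = ∑[ r ≤ k ] ∑[ c ≤ ν r ] ⟦ T r c ≡ p ⟧

columnContent : (ℕ → ℕ) → ℕ → (ℕ → ℕ → ℕ) → ℕ → ℕ → ℕ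
columnContent ν k T c p = ∑[ r ≤ k ] ⟦ c ≤ ν r ⟧ * ⟦ T r c ≡ p ⟧

columnContent-sum-≤-height : ∀ {ν T S} → Unique S → ∀ k c →
                             sum (map (columnContent ν k T c) S) ≤ (∑[ r ≤ k ] ⟦ c ≤ ν r ⟧)
columnContent-sum-≤-height {ν} {T} {S} S-unique k c = begin
  sum (map (λ p → ∑[ r ≤ k ] ⟦ c ≤ ν r ⟧ * ⟦ T r c ≡ p ⟧) S) ≡⟨ sum-map-∑ S k _ ⟩
  (∑[ r ≤ k ] sum (map (λ p → ⟦ c ≤ ν r ⟧ * ⟦ T r c ≡ p ⟧) S))
    ≡⟨ ∑-cong k (λ {r} _ _ → sum-map-*ˡ ⟦ c ≤ ν r ⟧ (λ p → ⟦ T r c ≡ p ⟧) S) ⟩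
  (∑[ r ≤ k ] ⟦ c ≤ ν r ⟧ * sum (map (λ p → ⟦ T r c ≡ p ⟧) S))
    ≤⟨ ∑-mono-≤ k (λ {r} _ _ → *-monoʳ-≤ ⟦ c ≤ ν r ⟧ (multiplicity-≤1 S-unique (T r c))) ⟩
  (∑[ r ≤ k ] ⟦ c ≤ ν r ⟧ * 1) ≡⟨ ∑-cong k (λ _ _ → *-identityʳ _) ⟩
  (∑[ r ≤ k ] ⟦ c ≤ ν r ⟧) ∎
  where open ≤-Reasoning

+-≤1-vanishing : ∀ {x y} → x ≤ 1 → y ≡ 0 → x + y ≤ 1
+-≤1-vanishing x≤1 refl = subst (_≤ 1) (sym (+-identityʳ _)) x≤1

module _ {ν : ℕ → ℕ} {T : ℕ → ℕ → ℕ} (ν-anti : Antitone⁺ ν) (T-strict : ColumnStrict ν T) where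

  column-< : ∀ {r q c} → 1 ≤ r → r < q → 1 ≤ c → c ≤ ν q → T r c < T q c
  column-< {r} {q} {c} 1≤r r<q 1≤c = go (≤⇒≤′ r<q)
    where
    go : ∀ {q} → suc r ≤′ q → c ≤ ν q → T r c < T q c
    go ≤′-refl                    c≤νq = T-strict 1≤r 1≤c c≤νq
    go (≤′-step {q} 1+r≤′q) c≤ν1+q =
      <-trans (go 1+r≤′q (≤-trans c≤ν1+q (ν-anti 1≤q))) (T-strict 1≤q 1≤c c≤ν1+q)
      where
      1≤q : 1 ≤ q
      1≤q = ≤-trans (s≤s z≤n) (≤′⇒≤ 1+r≤′q)

  first-column-≥-row : 1 ≤ T 1 1 → ∀ {r} → 1 ≤ r → 1 ≤ ν r → r ≤ T r 1
  first-column-≥-row 1≤T₁₁ {suc zero}    _ _      = 1≤T₁₁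
  first-column-≥-row 1≤T₁₁ {suc (suc r)} _ 1≤ν2+r =
    ≤-trans (s≤s (first-column-≥-row 1≤T₁₁ (s≤s z≤n) (≤-trans 1≤ν2+r (ν-anti (s≤s z≤n)))))
            (T-strict (s≤s z≤n) ≤-refl 1≤ν2+r)

  columnContent-≤1 : ∀ {c} → 1 ≤ c → ∀ k p → columnContent ν k T c p ≤ 1
  columnContent-≤1 1≤c zero    p = z≤n
  columnContent-≤1 {c} 1≤c (suc k) p with c ≤? ν (suc k) | T (suc k) c ≟ p
  ... | no c≰ν  | _        =
    +-≤1-vanishing (columnContent-≤1 1≤c k p) (cong (_* _) (⟦≤⟧-> (≰⇒> c≰ν)))
  ... | yes _   | no T≢p   =
    +-≤1-vanishing (columnContent-≤1 1≤c k p)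
                   (trans (cong (⟦ c ≤ ν (suc k) ⟧ *_) (⟦≡⟧-≢ T≢p)) (*-zeroʳ ⟦ c ≤ ν (suc k) ⟧))
  ... | yes c≤ν | yes refl =
    ≤-reflexive (cong₂ _+_ earlier-rows (cong₂ _*_ (⟦≤⟧-≤ c≤ν) (⟦≡⟧-refl (T (suc k) c))))
    where
    earlier-rows : columnContent ν k T c (T (suc k) c) ≡ 0
    earlier-rows = trans (∑-cong k smaller-entry) (∑-zero k)
      where
      smaller-entry : ∀ {r} → 1 ≤ r → r ≤ k → ⟦ c ≤ ν r ⟧ * ⟦ T r c ≡ T (suc k) c ⟧ ≡ 0
      smaller-entry {r} 1≤r r≤k =
        trans (cong (⟦ c ≤ ν r ⟧ *_) (⟦≡⟧-≢ (<⇒≢ (column-< 1≤r (s≤s r≤k) 1≤c c≤ν))))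
              (*-zeroʳ ⟦ c ≤ ν r ⟧)

  columnContent-sum-≤ : ∀ {S j c} k → Unique S → length S ≤ j → 1 ≤ c →
                        sum (map (columnContent ν k T c) S) ≤ (∑[ r ≤ j ] ⟦ c ≤ ν r ⟧)
  columnContent-sum-≤ {S} {j} {c} k S-unique |S|≤j 1≤c =
    ∑-⟦≤⟧-prefix ν-anti {c} j k (≤-trans (sum-map-≤-length S (columnContent-≤1 1≤c k)) |S|≤j)
                            (columnContent-sum-≤-height {ν} {T} S-unique k c)

  content-dominance : ∀ {S j} k → Unique S → length S ≤ j →
                      sum (map (content ν k T) S) ≤ (∑[ r ≤ j ] ν r)
  content-dominance {S} {j} k S-unique |S|≤j = begin
    sum (map (content ν k T) S)
      ≡⟨ cong sum (map-cong (λ p → ∑-transpose ν-anti k (λ r c → ⟦ T r c ≡ p ⟧)) S) ⟩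
    sum (map (λ p → ∑[ c ≤ ν 1 ] columnContent ν k T c p) S)
      ≡⟨ sum-map-∑ S (ν 1) _ ⟩
    (∑[ c ≤ ν 1 ] sum (map (columnContent ν k T c) S))
      ≤⟨ ∑-mono-≤ (ν 1) (λ 1≤c _ → columnContent-sum-≤ k S-unique |S|≤j 1≤c) ⟩
    (∑[ c ≤ ν 1 ] ∑[ r ≤ j ] ⟦ c ≤ ν r ⟧)
      ≡⟨ ∑-row-lengths ν-anti j ⟨
    (∑[ r ≤ j ] ν r) ∎
    where open ≤-Reasoning

-- Semistandard tableaux

length-filter≡sum : ∀ {a p} {A : Set a} {P : Pred A p} (P? : Decidable P) xs →
                    length (filter P? xs) ≡ sum (map (λ x → 𝟙 (does (P? x))) xs)
length-filter≡sum P? []       = refl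
length-filter≡sum P? (x ∷ xs) with does (P? x)
... | true  = cong suc (length-filter≡sum P? xs)
... | false = length-filter≡sum P? xs

sum-map-concatMap : ∀ {a b} {A : Set a} {B : Set b} (f : B → ℕ) (F : A → List B) xs →
                    sum (map f (concatMap F xs)) ≡ sum (map (λ x → sum (map f (F x))) xs)
sum-map-concatMap f F []       = refl
sum-map-concatMap f F (x ∷ xs) = begin
  sum (map f (F x ++ concatMap F xs))               ≡⟨ cong sum (map-++ f (F x) _) ⟩
  sum (map f (F x) ++ map f (concatMap F xs))       ≡⟨ sum-++ (map f (F x)) _ ⟩
  sum (map f (F x)) + sum (map f (concatMap F xs))  ≡⟨ cong (_ +_) (sum-map-concatMap f F xs) ⟩
  sum (map f (F x)) + sum (map (λ x → sum (map f (F x))) xs) ∎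
  where open ≡-Reasoning

sum-map-upFrom1 : ∀ m f → sum (map f (upFrom1 m)) ≡ ∑ m f
sum-map-upFrom1 zero    f = refl
sum-map-upFrom1 (suc m) f = begin
  sum (map f (upFrom1 m ∷ʳ suc m))          ≡⟨ cong sum (map-++ f (upFrom1 m) _) ⟩
  sum (map f (upFrom1 m) ∷ʳ f (suc m))      ≡⟨ sum-++ (map f (upFrom1 m)) _ ⟩
  sum (map f (upFrom1 m)) + (f (suc m) + 0) ≡⟨ cong₂ _+_ (sum-map-upFrom1 m f) (+-identityʳ _) ⟩
  ∑ m f + f (suc m)                         ∎
  where open ≡-Reasoning

countValue≡content : ∀ μ T p → countValue μ T p ≡ content (at μ) (length μ) T p
countValue≡content μ T p = begin
  countValue μ T p
    ≡⟨ length-filter≡sum (λ c → T (proj₁ c) (proj₂ c) ≟ p) (cells μ) ⟩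
  sum (map δ (cells μ))
    ≡⟨ sum-map-concatMap δ row (upFrom1 (length μ)) ⟩
  sum (map (λ r → sum (map δ (row r))) (upFrom1 (length μ)))
    ≡⟨ cong sum (map-cong (λ r → sym (cong sum (map-∘ (upFrom1 (at μ r))))) (upFrom1 (length μ))) ⟩
  sum (map (λ r → sum (map (λ c → ⟦ T r c ≡ p ⟧) (upFrom1 (at μ r)))) (upFrom1 (length μ)))
    ≡⟨ cong sum (map-cong (λ r → sum-map-upFrom1 (at μ r) _) (upFrom1 (length μ))) ⟩
  sum (map (λ r → ∑[ c ≤ at μ r ] ⟦ T r c ≡ p ⟧) (upFrom1 (length μ)))
    ≡⟨ sum-map-upFrom1 (length μ) _ ⟩
  content (at μ) (length μ) T p ∎
  where
  open ≡-Reasoning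
  δ : ℕ × ℕ → ℕ
  δ (r , c) = ⟦ T r c ≡ p ⟧
  row : ℕ → List (ℕ × ℕ)
  row r = map (r ,_) (upFrom1 (at μ r))

content-remove-cell : ∀ {μ ν : ℕ → ℕ} {k i} T p → (∀ r → ν r ≡ μ r ∸ ⟦ i ≡ r ⟧) →
                      1 ≤ i → i ≤ k → 1 ≤ μ i →
                      content μ k T p ≡ content ν k T p + ⟦ T i (μ i) ≡ p ⟧
content-remove-cell {μ} {ν} {k} {i} T p ν≡μ∸ 1≤i i≤k 1≤μᵢ = ∑-update k 1≤i i≤k other-row corner-row
  where
  other-row : ∀ {r} → r ≢ i → (∑[ c ≤ μ r ] ⟦ T r c ≡ p ⟧) ≡ (∑[ c ≤ ν r ] ⟦ T r c ≡ p ⟧)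
  other-row {r} r≢i = cong (λ m → ∑[ c ≤ m ] ⟦ T r c ≡ p ⟧)
                           (sym (trans (ν≡μ∸ r) (cong (μ r ∸_) (⟦≡⟧-≢ (r≢i ∘ sym)))))
  corner-row : (∑[ c ≤ μ i ] ⟦ T i c ≡ p ⟧) ≡ (∑[ c ≤ ν i ] ⟦ T i c ≡ p ⟧) + ⟦ T i (μ i) ≡ p ⟧
  corner-row = trans (∑-pred (λ c → ⟦ T i c ≡ p ⟧) 1≤μᵢ)
                     (cong (λ m → (∑[ c ≤ m ] ⟦ T i c ≡ p ⟧) + ⟦ T i (μ i) ≡ p ⟧)
                           (sym (trans (ν≡μ∸ i) (cong (μ i ∸_) (⟦≡⟧-refl i)))))

content-entry : ∀ {ν k T r c} → 1 ≤ r → r ≤ k → 1 ≤ c → c ≤ ν r → 1 ≤ content ν k T (T r c)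
content-entry {ν} {k} {T} {r} {c} 1≤r r≤k 1≤c c≤νr = begin
  1                                   ≡⟨ ⟦≡⟧-refl (T r c) ⟨
  ⟦ T r c ≡ T r c ⟧                   ≤⟨ ∑-term-≤ (λ c′ → ⟦ T r c′ ≡ T r c ⟧) 1≤c c≤νr ⟩
  (∑[ c′ ≤ ν r ] ⟦ T r c′ ≡ T r c ⟧)  ≤⟨ ∑-term-≤ (λ r′ → ∑[ c′ ≤ ν r′ ] ⟦ T r′ c′ ≡ T r c ⟧) 1≤r r≤k ⟩
  content ν k T (T r c)               ∎
  where open ≤-Reasoning

module CornerRemoval
  {μ a : List ℕ} {T : ℕ → ℕ → ℕ} {i : ℕ}
  (μ-dec : NonIncreasing μ) (T-tableau : IsSTab μ a T)
  (1≤i : 1 ≤ i) (1≤μᵢ : 1 ≤ at μ i) (T-corner : T i (at μ i) ≡ length a)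
  where

  private
    k h : ℕ
    k = length μ
    h = length a

    ν : ℕ → ℕ
    ν = at (decAt μ i)

    T-range : ∀ r c → InDiagram μ r c → 1 ≤ T r c × T r c ≤ h
    T-range = proj₁ T-tableau

    T-column : ∀ r c → InDiagram μ r c → InDiagram μ (suc r) c → T r c < T (suc r) c
    T-column = proj₁ (proj₂ (proj₂ T-tableau))

    T-count : ∀ p → 1 ≤ p → p ≤ h → countValue μ T p ≡ at a p
    T-count = proj₂ (proj₂ (proj₂ T-tableau))

    μ-anti : Antitone⁺ (at μ)
    μ-anti = NonIncreasing⇒antitone⁺ μ-dec

    cell : ∀ {r c} → 1 ≤ r → 1 ≤ c → c ≤ at μ r → InDiagram μ r c
    cell 1≤r 1≤c c≤μr = 1≤r , at-pos⇒≤length μ (≤-trans 1≤c c≤μr) , 1≤c , c≤μr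

    μ-strict : ColumnStrict (at μ) T
    μ-strict 1≤r 1≤c c≤μ₁₊ᵣ =
      T-column _ _ (cell 1≤r 1≤c (≤-trans c≤μ₁₊ᵣ (μ-anti 1≤r))) (cell (s≤s z≤n) 1≤c c≤μ₁₊ᵣ)

  corner-removable : at μ (suc i) < at μ i
  corner-removable with m≤n⇒m<n∨m≡n (μ-anti 1≤i)
  ... | inj₁ μ₁₊ᵢ<μᵢ = μ₁₊ᵢ<μᵢ
  ... | inj₂ μ₁₊ᵢ≡μᵢ = contradiction (proj₂ (T-range _ _ below-corner)) (<⇒≱ h<T₁₊ᵢ)
    where
    μᵢ≤μ₁₊ᵢ : at μ i ≤ at μ (suc i)
    μᵢ≤μ₁₊ᵢ = ≤-reflexive (sym μ₁₊ᵢ≡μᵢ)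
    below-corner : InDiagram μ (suc i) (at μ i)
    below-corner = cell (s≤s z≤n) 1≤μᵢ μᵢ≤μ₁₊ᵢ
    h<T₁₊ᵢ : h < T (suc i) (at μ i)
    h<T₁₊ᵢ = subst (_< T (suc i) (at μ i)) T-corner (μ-strict 1≤i 1≤μᵢ μᵢ≤μ₁₊ᵢ)

  private
    ν≤μ : ∀ r → ν r ≤ at μ r
    ν≤μ r = subst (_≤ at μ r) (sym (at-decAt μ i r)) (m∸n≤m (at μ r) ⟦ i ≡ r ⟧)

    ν-anti : Antitone⁺ ν
    ν-anti {r} 1≤r with i ≟ r
    ... | yes refl = begin
      ν (suc i)                      ≡⟨ at-decAt μ i (suc i) ⟩
      at μ (suc i) ∸ ⟦ i ≡ suc i ⟧    ≡⟨ cong (at μ (suc i) ∸_) (⟦≡⟧-≢ (<⇒≢ (n<1+n i))) ⟩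
      at μ (suc i)                   ≤⟨ <⇒≤pred corner-removable ⟩
      at μ i ∸ 1                     ≡⟨ cong (at μ i ∸_) (⟦≡⟧-refl i) ⟨
      at μ i ∸ ⟦ i ≡ i ⟧              ≡⟨ at-decAt μ i i ⟨
      ν i                            ∎
      where open ≤-Reasoning
    ... | no i≢r = begin
      ν (suc r)            ≤⟨ ν≤μ (suc r) ⟩
      at μ (suc r)         ≤⟨ μ-anti 1≤r ⟩
      at μ r               ≡⟨ cong (at μ r ∸_) (⟦≡⟧-≢ i≢r) ⟨
      at μ r ∸ ⟦ i ≡ r ⟧   ≡⟨ at-decAt μ i r ⟨
      ν r                  ∎
      where open ≤-Reasoning

    ν-strict : ColumnStrict ν T
    ν-strict 1≤r 1≤c c≤ν₁₊ᵣ = μ-strict 1≤r 1≤c (≤-trans c≤ν₁₊ᵣ (ν≤μ _))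

    content-ν : ∀ {p} → 1 ≤ p → p ≤ h → content ν k T p ≡ at (tilde a) p
    content-ν {p} 1≤p p≤h = begin
      content ν k T p
        ≡⟨ m+n∸n≡m _ ⟦ h ≡ p ⟧ ⟨
      content ν k T p + ⟦ h ≡ p ⟧ ∸ ⟦ h ≡ p ⟧
        ≡⟨ cong (λ v → content ν k T p + ⟦ v ≡ p ⟧ ∸ ⟦ h ≡ p ⟧) T-corner ⟨
      content ν k T p + ⟦ T i (at μ i) ≡ p ⟧ ∸ ⟦ h ≡ p ⟧
        ≡⟨ cong (_∸ ⟦ h ≡ p ⟧) removed-corner ⟨
      content (at μ) k T p ∸ ⟦ h ≡ p ⟧
        ≡⟨ cong (_∸ ⟦ h ≡ p ⟧) (countValue≡content μ T p) ⟨
      countValue μ T p ∸ ⟦ h ≡ p ⟧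
        ≡⟨ cong (_∸ ⟦ h ≡ p ⟧) (T-count p 1≤p p≤h) ⟩
      at a p ∸ ⟦ h ≡ p ⟧
        ≡⟨ at-tilde a p ⟨
      at (tilde a) p ∎
      where
      open ≡-Reasoning
      removed-corner : content (at μ) k T p ≡ content ν k T p + ⟦ T i (at μ i) ≡ p ⟧
      removed-corner = content-remove-cell T p (at-decAt μ i) 1≤i (at-pos⇒≤length μ 1≤μᵢ) 1≤μᵢ

    tilde≤content : ∀ p → at (tilde a) p ≤ content ν k T p
    tilde≤content zero    = ≤-trans (at-tilde-≤ a 0) (≤-trans (≤-reflexive (at-zero a)) z≤n)
    tilde≤content (suc p) with suc p ≤? h
    ... | yes p≤h = ≤-reflexive (sym (content-ν (s≤s z≤n) p≤h))
    ... | no  p≰h = ≤-trans (at-tilde-≤ a (suc p)) (≤-trans (≤-reflexive (at-beyond a (≰⇒> p≰h))) z≤n)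

    rows-bounded : ∀ {r} → 1 ≤ r → 1 ≤ ν r → r ≤ length (tilde a)
    rows-bounded {r} 1≤r 1≤νr = begin
      r     ≤⟨ first-column-≥-row μ-anti μ-strict (proj₁ (T-range 1 1 top-left)) 1≤r 1≤μr ⟩
      T r 1 ≤⟨ at-pos⇒≤length (tilde a)
                 (subst (1 ≤_) (content-ν (proj₁ T-in-range) (proj₂ T-in-range)) T-occurs) ⟩
      length (tilde a) ∎
      where
      open ≤-Reasoning
      1≤μr : 1 ≤ at μ r
      1≤μr = ≤-trans 1≤νr (ν≤μ r)
      top-left : InDiagram μ 1 1
      top-left = cell ≤-refl ≤-refl (≤-trans 1≤μr (antitone⁺-≤ μ-anti ≤-refl 1≤r))
      T-in-range : 1 ≤ T r 1 × T r 1 ≤ h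
      T-in-range = T-range r 1 (cell 1≤r ≤-refl 1≤μr)
      T-occurs : 1 ≤ content ν k T (T r 1)
      T-occurs = content-entry {ν} {k} {T} 1≤r (at-pos⇒≤length μ 1≤μr) ≤-refl 1≤νr

  length-condition : length (lower μ i) ≤ length (sortDesc (tilde a))
  length-condition = subst (length (lower μ i) ≤_) (sym (length-sortDesc (tilde a)))
                           (length-dropTrailingZeros-≤ (decAt μ i) _ vanishes)
    where
    vanishes : ∀ {r} → length (tilde a) < r → ν r ≡ 0
    vanishes {r} lt with 1 ≤? ν r
    ... | yes 1≤νr = contradiction (rows-bounded (≤-trans (s≤s z≤n) lt) 1≤νr) (<⇒≱ lt)
    ... | no  νr≱1 = n<1⇒n≡0 (≰⇒> νr≱1)

  dominance : ∀ j → psum (sortDesc (tilde a)) j ≤ psum (lower μ i) j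
  dominance j with psum-sortDesc≤sum-at (tilde a) j
  ... | S , S-unique , _ , |S|≤j , sorted≤S = begin
    psum (sortDesc (tilde a)) j    ≤⟨ sorted≤S ⟩
    sum (map (at (tilde a)) S)     ≤⟨ sum-map-mono-≤ S tilde≤content ⟩
    sum (map (content ν k T) S)    ≤⟨ content-dominance ν-anti ν-strict k S-unique |S|≤j ⟩
    (∑[ r ≤ j ] ν r)               ≡⟨ ∑-cong j (λ {r} _ _ → at-dropTrailingZeros (decAt μ i) r) ⟨
    (∑[ r ≤ j ] at (lower μ i) r)  ≡⟨ psum≡∑at (lower μ i) j ⟨
    psum (lower μ i) j             ∎
    where open ≤-Reasoning

lemma2p6 : (n : ℕ) (μ a : List ℕ) (i : ℕ)
    → IsPartition μ n → IsComposition a n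
    → 1 ≤ i → i ≤ length μ
    → Σ (ℕ → ℕ → ℕ) (λ T → IsSTab μ a T × T i (at μ i) ≡ length a)
    → InR μ a i
lemma2p6 n μ a i ((μ-pos , _) , μ-dec) _ 1≤i i≤k (T , T-tableau , T-corner) =
  1≤i , i≤k , corner-removable , length-condition , λ j _ _ → dominance j
  where open CornerRemoval {a = a} μ-dec T-tableau 1≤i (All⇒at μ μ-pos 1≤i i≤k) T-corner
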